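{- For every positive integer $n$, $\operatorname{OTI}(K_n)=\left[\lceil 2\sqrt n-1\rceil,\ n\right]$; that is, the minimum of $\operatorname{th}(\vec K_n)$ over all orientations $\vec K_n$ of the complete graph $K_n$ equals $\lceil 2\sqrt n-1\rceil$ and the maximum equals $n$.
   Context: An orientation of a simple undirected graph $G$ is a digraph obtained by replacing each edge $\{u,v\}$ with exactly one of the arcs $(u,v)$, $(v,u)$. Zero forcing on a digraph: vertices are blue or white; a blue vertex $u$ with exactly one white out-neighbor $w$ may force $w$ ($u\to w$), turning it blue. A set $\mathcal F$ of forces is a set of forces of $B\subseteq V$ if, starting with exactly $B$ blue, the forces in $\mathcal F$ can be validly performed in some order after which no further force is possible. Put $\mathcal F^{[0]}=B$ and $\mathcal F^{[t+1]}=\mathcal F^{[t]}\cup\{w\notin\mathcal F^{[t]}:(u\to w)\in\mathcal F,\ u\in\mathcal F^{[t]},\ w$ the only out-neighbor of $u$ outside $\mathcal F^{[t]}\}$; $\operatorname{pt}(\Gamma;\mathcal F)$ is the least $t$ with $\mathcal F^{[t]}=V$ ($\infty$ if none); $\operatorname{pt}(\Gamma;B)=\min_{\mathcal F}\operatorname{pt}(\Gamma;\mathcal F)$. The throttling number is $\operatorname{th}(\Gamma)=\min_{B\subseteq V}(|B|+\operatorname{pt}(\Gamma;B))$. The orientation throttling interval $\operatorname{OTI}(G)$ is the set of integers in $[m,M]$, where $m$ and $M$ are the minimum and maximum of $\operatorname{th}(\vec G)$ over all orientations $\vec G$ of $G$. -}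

module Defs where

open import Data.Nat using (ℕ; zero; suc; _+_; _*_; _≤_)
open import Data.Bool using (Bool; true; false; not; _∧_)
open import Data.Fin using (Fin; _≟_)
open import Data.Fin.Subset using (Subset; _∈_; _∉_; ⁅_⁆; _∪_; ∣_∣)
open import Data.List using (List; []; _∷_)
open import Data.List.Membership.Propositional using () renaming (_∈_ to _∈ₗ_)
open import Data.Product using (_×_; _,_; ∃; ∃-syntax; Σ-syntax)
open import Data.Sum using (_⊎_)
open import Data.Unit using (⊤)
open import Relation.Nullary using (¬_)
open import Relation.Nullary.Decidable using (⌊_⌋)
open import Relation.Binary.PropositionalEquality using (_≡_)

-- A simple graph / digraph on vertex set Fin n, given by a Boolean adjacency
-- matrix.  For a digraph A, A u v ≡ true means that (u , v) is an arc.
Adj : ℕ → Set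
Adj n = Fin n → Fin n → Bool

K : (n : ℕ) → Adj n
K n u v = not ⌊ u ≟ v ⌋

IsOrientation : ∀ {n} → Adj n → Adj n → Set
IsOrientation {n} G A =
  (∀ (u v : Fin n) → A u v ≡ true → G u v ≡ true) ×
  (∀ (u v : Fin n) → G u v ≡ true →
     (A u v ≡ true ⊎ A v u ≡ true) × ¬ (A u v ≡ true × A v u ≡ true))

CanForce : ∀ {n} → Adj n → Subset n → Fin n → Fin n → Set
CanForce {n} A S u w =
  u ∈ S × w ∉ S × A u w ≡ true ×
  (∀ (x : Fin n) → A u x ≡ true → x ∉ S → x ≡ w)

Force : ℕ → Set
Force n = Fin n × Fin n

run : ∀ {n} → Subset n → List (Force n) → Subset n
run S [] = S
run S ((u , w) ∷ L) = run (S ∪ ⁅ w ⁆) L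

ValidSeq : ∀ {n} → Adj n → Subset n → List (Force n) → Set
ValidSeq A S [] = ⊤
ValidSeq A S ((u , w) ∷ L) = CanForce A S u w × ValidSeq A (S ∪ ⁅ w ⁆) L

-- The set of forces of such a list is a "set of forces of B", and every set
-- of forces of B arises in this way (from a valid order of its elements).
IsForceSeq : ∀ {n} → Adj n → Subset n → List (Force n) → Set
IsForceSeq {n} A B L =
  ValidSeq A B L × (∀ (u w : Fin n) → ¬ CanForce A (run B L) u w)

-- The sets F^[t] for the set of forces F = {forces occurring in L}.
Rounds : ∀ {n} → Adj n → Subset n → List (Force n) → ℕ → Fin n → Set
Rounds A B L zero v = v ∈ B
Rounds {n} A B L (suc t) w =
  Rounds A B L t w ⊎
  (¬ Rounds A B L t w ×
   ∃[ u ] ((u , w) ∈ₗ L × Rounds A B L t u × A u w ≡ true ×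
           (∀ (x : Fin n) → A u x ≡ true → ¬ Rounds A B L t x → x ≡ w)))

AllBlueAt : ∀ {n} → Adj n → Subset n → List (Force n) → ℕ → Set
AllBlueAt {n} A B L t = ∀ (v : Fin n) → Rounds A B L t v

Achieves : ∀ {n} → Adj n → Subset n → ℕ → Set
Achieves A B t = ∃[ L ] (IsForceSeq A B L × AllBlueAt A B L t)

IsThrottlingNumber : ∀ {n} → Adj n → ℕ → Set
IsThrottlingNumber {n} A k =
  (∃[ B ] ∃[ t ] (Achieves A B t × ∣ B ∣ + t ≡ k)) ×
  (∀ (B : Subset n) (t : ℕ) → Achieves A B t → k ≤ ∣ B ∣ + t)

IsMinOrientTh : ∀ {n} → Adj n → ℕ → Set
IsMinOrientTh {n} G m =
  (∃[ A ] (IsOrientation G A × IsThrottlingNumber A m)) ×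
  (∀ (A : Adj n) (k : ℕ) → IsOrientation G A → IsThrottlingNumber A k → m ≤ k)

IsMaxOrientTh : ∀ {n} → Adj n → ℕ → Set
IsMaxOrientTh {n} G M =
  (∃[ A ] (IsOrientation G A × IsThrottlingNumber A M)) ×
  (∀ (A : Adj n) (k : ℕ) → IsOrientation G A → IsThrottlingNumber A k → k ≤ M)

-- c = ⌈ 2 √n − 1 ⌉ (for n ≥ 1): c is the least natural number with
-- c ≥ 2√n − 1, i.e. (c+1)² ≥ 4n.
IsCeil2SqrtMinus1 : ℕ → ℕ → Set
IsCeil2SqrtMinus1 n c =
  4 * n ≤ suc c * suc c × (∀ (d : ℕ) → 4 * n ≤ suc d * suc d → c ≤ d)

module Submission where

-- In a forcing process every vertex forces at most once, so
-- the forces arrange the vertices into chains, each starting at an initially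
-- blue vertex and growing by at most one vertex per round.  Hence if all of
-- V is blue after t rounds then n ≤ |B|(t + 1) (chain-bound), and by AM–GM
-- 4n ≤ (|B| + t + 1)², i.e. |B| + t ≥ ⌈2√n − 1⌉, for every digraph.  In the
-- transitive tournament at most one vertex is forced per round, so there
-- n ≤ |B| + t (transitive-bound).
--
-- Always th ≤ n (start with everything blue).  The jump
-- tournament on 0, …, N − 1 has arcs u → u + a and u → w for w < u, u ≠ w + a.
-- From B = {0, …, a − 1} the forces k → k + a make exactly the vertices
-- below (d + 1)a blue after d rounds (JumpForcing); a and t with a + t ≤
-- ⌈2√n − 1⌉ and n ≤ (t + 1)a exist (jump-parameters), which attains the
-- minimum.  For a = n the jump tournament is the transitive tournament,
-- which attains the maximum n.

open import Defs
open import Data.Bool using (Bool; true; not; _∧_; _∨_)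
open import Data.Empty using (⊥-elim)
open import Data.Fin as Fin using (Fin; toℕ; fromℕ<; combine; join; splitAt)
open import Data.Fin.Properties as Finₚ
  using (toℕ-injective; toℕ-fromℕ<; fromℕ<-injective; combine-injective; splitAt-join; injective⇒≤)
open import Data.Fin.Subset using (Subset; _∈_; ∣_∣; ⊤; inside; outside; _∪_; ⁅_⁆)
open import Data.Fin.Subset.Properties using (∈⊤; ∣⊤∣≡n; x∈p∪q⁻; x∈p∪q⁺; x∈⁅y⁆⇒x≡y; x∈⁅x⁆)
open import Data.List using (List; []; _∷_)
open import Data.List.Membership.Propositional using () renaming (_∈_ to _∈ₗ_)
import Data.List.Relation.Unary.Any as Any
open import Data.Nat using (ℕ; zero; suc; _+_; _*_; _∸_; _≤_; _<_; z≤n; s≤s; _<?_; _≟_)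
open import Data.Nat.DivMod using (_mod_; m<n⇒m%n≡m)
open import Data.Nat.Properties
open import Data.Nat.Tactic.RingSolver using (solve-∀)
open import Data.Product using (_×_; _,_; proj₁; proj₂; ∃₂; ∃-syntax)
open import Data.Product.Properties using (,-injective)
open import Data.Sum as Sum using (_⊎_; inj₁; inj₂)
open import Data.Sum.Properties using (inj₁-injective; inj₂-injective)
open import Data.Unit using (tt)
open import Data.Vec.Base using (_∷_; []; here; there)
open import Function using (case_of_)
open import Relation.Nullary using (¬_; yes; no)
open import Relation.Nullary.Decidable using (⌊_⌋)
open import Relation.Binary.PropositionalEquality
open import Relation.Binary.Definitions using (tri<; tri≈; tri>)



-- Counting by injections

rank : ∀ {n} (S : Subset n) {x : Fin n} → x ∈ S → Fin ∣ S ∣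
rank (inside ∷ S) here = Fin.zero
rank (inside ∷ S) (there p) = Fin.suc (rank S p)
rank (outside ∷ S) (there p) = rank S p

rank-injective : ∀ {n} (S : Subset n) {x y : Fin n} (p : x ∈ S) (q : y ∈ S) →
  rank S p ≡ rank S q → x ≡ y
rank-injective (inside ∷ S) here here _ = refl
rank-injective (inside ∷ S) here (there q) ()
rank-injective (inside ∷ S) (there p) here ()
rank-injective (inside ∷ S) (there p) (there q) e =
  cong Fin.suc (rank-injective S p q (Finₚ.suc-injective e))
rank-injective (outside ∷ S) (there p) (there q) e = cong Fin.suc (rank-injective S p q e)

injective-×⇒≤ : ∀ {k m n} (f : Fin k → Fin m) (g : Fin k → Fin n) →
  (∀ {x y} → f x ≡ f y → g x ≡ g y → x ≡ y) → k ≤ m * n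
injective-×⇒≤ f g inj = injective⇒≤ {f = λ x → combine (f x) (g x)}
  (λ {x} {y} e → let (fx≡fy , gx≡gy) = combine-injective (f x) (g x) (f y) (g y) e
                 in inj fx≡fy gx≡gy)

injective-⊎⇒≤ : ∀ {k m n} (f : Fin k → Fin m ⊎ Fin n) →
  (∀ {x y} → f x ≡ f y → x ≡ y) → k ≤ m + n
injective-⊎⇒≤ {m = m} {n} f inj = injective⇒≤ {f = λ x → join m n (f x)}
  (λ {x} {y} e → inj (begin
    f x                        ≡⟨ splitAt-join m n (f x) ⟨
    splitAt m (join m n (f x)) ≡⟨ cong (splitAt m) e ⟩
    splitAt m (join m n (f y)) ≡⟨ splitAt-join m n (f y) ⟩
    f y                        ∎))
  where open ≡-Reasoning

-- Forcing chains and lower bounds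

IsTransitive : ∀ {n} → Adj n → Set
IsTransitive {n} A =
  ∀ (u w : Fin n) → (A u w ≡ true → toℕ w < toℕ u) × (toℕ w < toℕ u → A u w ≡ true)

transitive-below : ∀ {n} {A : Adj n} → IsTransitive A →
  ∀ {u w x} → A u w ≡ true → toℕ x < toℕ w → A u x ≡ true
transitive-below tr {u} {w} {x} auw x<w = proj₂ (tr u x) (<-trans x<w (proj₁ (tr u w) auw))

module Chains {n : ℕ} (A : Adj n) (B : Subset n) (L : List (Force n)) where

  R : ℕ → Fin n → Set
  R = Rounds A B L

  rounds-mono : ∀ {s s' v} → s ≤ s' → R s v → R s' v
  rounds-mono {s' = zero} z≤n r = r
  rounds-mono {s' = suc s'} s≤1+s' r with m≤n⇒m<n∨m≡n s≤1+s'
  ... | inj₁ s<1+s' = inj₁ (rounds-mono (≤-pred s<1+s') r)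
  ... | inj₂ refl = r

  -- u forces the vertex v, still white after s rounds, in round s + 1.
  record Forces (s : ℕ) (u v : Fin n) : Set where
    constructor forces
    field
      white : ¬ R s v
      blue : R s u
      arc : A u v ≡ true
      only : ∀ x → A u x ≡ true → ¬ R s x → x ≡ v
  open Forces

  -- Every vertex forces at most once: a later target would have been a
  -- second white out-neighbour at the time of the earlier force.
  single-target : ∀ {s s' u v w} → Forces s u v → Forces s' u w → v ≡ w
  single-target {s} {s'} fv fw with ≤-total s s'
  ... | inj₁ s≤s' = sym (only fv _ (arc fw) (λ r → white fw (rounds-mono s≤s' r)))
  ... | inj₂ s'≤s = only fw _ (arc fv) (λ r → white fv (rounds-mono s'≤s r))

  -- The root of a forcing chain through a vertex blue after t rounds and
  -- the vertex's distance from it, found by following forces backwards.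
  trace : ∀ t {v} → R t v → Fin n × ℕ
  trace zero {v} _ = v , 0
  trace (suc t) (inj₁ r) = trace t r
  trace (suc t) (inj₂ (_ , _ , _ , ru , _)) = proj₁ (trace t ru) , suc (proj₂ (trace t ru))

  trace-root : ∀ t {v} (p : R t v) → proj₁ (trace t p) ∈ B
  trace-root zero p = p
  trace-root (suc t) (inj₁ r) = trace-root t r
  trace-root (suc t) (inj₂ (_ , _ , _ , ru , _)) = trace-root t ru

  trace-depth : ∀ t {v} (p : R t v) → proj₂ (trace t p) ≤ t
  trace-depth zero p = z≤n
  trace-depth (suc t) (inj₁ r) = m≤n⇒m≤1+n (trace-depth t r)
  trace-depth (suc t) (inj₂ (_ , _ , _ , ru , _)) = s≤s (trace-depth t ru)

  -- Distinct vertices have distinct (root, depth): two chains from a common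
  -- root agree level by level, since each vertex forces only once.
  trace-injective : ∀ t t' {v w} (p : R t v) (q : R t' w) → trace t p ≡ trace t' q → v ≡ w
  trace-injective (suc t) t' (inj₁ p) q e = trace-injective t t' p q e
  trace-injective t (suc t') p (inj₁ q) e = trace-injective t t' p q e
  trace-injective zero zero p q e = cong proj₁ e
  trace-injective zero (suc t') p (inj₂ _) e = ⊥-elim (0≢1+n (cong proj₂ e))
  trace-injective (suc t) zero (inj₂ _) q e = ⊥-elim (1+n≢0 (cong proj₂ e))
  trace-injective (suc t) (suc t') (inj₂ (nv , _ , _ , ru , av , ov))
                                   (inj₂ (nw , _ , _ , ru' , aw , ow)) e
    with trace-injective t t' ru ru'
           (cong₂ _,_ (proj₁ (,-injective e)) (suc-injective (proj₂ (,-injective e))))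
  ... | refl = single-target (forces nv ru av ov) (forces nw ru' aw ow)

  arrival : ∀ t {v} → R t v → v ∈ B ⊎ ∃[ s ] (s < t × ∃[ u ] Forces s u v)
  arrival zero p = inj₁ p
  arrival (suc t) (inj₁ p) = Sum.map₂ (λ (s , s<t , f) → s , m<n⇒m<1+n s<t , f) (arrival t p)
  arrival (suc t) (inj₂ (nv , u , _ , ru , av , ov)) = inj₂ (t , ≤-refl , u , forces nv ru av ov)

  -- In the transitive tournament at most one vertex is forced per round: of
  -- two white targets, the smaller one is an out-neighbour of the forcer of
  -- the larger one.
  one-per-round : IsTransitive A → ∀ {s u u' v w} → Forces s u v → Forces s u' w → v ≡ w
  one-per-round tr {v = v} {w} fv fw with <-cmp (toℕ v) (toℕ w)
  ... | tri< v<w _ _ = only fw v (transitive-below tr (arc fw) v<w) (white fv)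
  ... | tri≈ _ v≡w _ = toℕ-injective v≡w
  ... | tri> _ _ w<v = sym (only fv w (transitive-below tr (arc fv) w<v) (white fw))

-- If all of V is blue after t rounds from B, then n ≤ |B|(t + 1): a vertex
-- is determined by the root of its forcing chain and its depth ≤ t.
chain-bound : ∀ {n} {A : Adj n} {B t} → Achieves A B t → n ≤ ∣ B ∣ * suc t
chain-bound {A = A} {B} {t} (L , _ , allBlue) = injective-×⇒≤ root depth
  (λ root≡ depth≡ → trace-injective t t _ _
     (cong₂ _,_ (rank-injective B _ _ root≡) (fromℕ<-injective _ _ _ _ depth≡)))
  where
  open Chains A B L
  root : Fin _ → Fin ∣ B ∣
  root v = rank B (trace-root t (allBlue v))
  depth : Fin _ → Fin (suc t)
  depth v = fromℕ< (s≤s (trace-depth t (allBlue v)))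

-- In the transitive tournament n ≤ |B| + t: a vertex is either initially
-- blue or determined by the round in which it is forced.
transitive-bound : ∀ {n} {A : Adj n} → IsTransitive A → ∀ {B t} → Achieves A B t → n ≤ ∣ B ∣ + t
transitive-bound {A = A} tr {B} {t} (L , _ , allBlue) = injective-⊎⇒≤ code code-injective
  where
  open Chains A B L
  code : Fin _ → Fin ∣ B ∣ ⊎ Fin t
  code v with arrival t (allBlue v)
  ... | inj₁ v∈B = inj₁ (rank B v∈B)
  ... | inj₂ (s , s<t , _) = inj₂ (fromℕ< s<t)
  code-injective : ∀ {v w} → code v ≡ code w → v ≡ w
  code-injective {v} {w} with arrival t (allBlue v) | arrival t (allBlue w)
  ... | inj₁ p | inj₁ q = λ e → rank-injective B p q (inj₁-injective e)
  ... | inj₁ _ | inj₂ _ = λ ()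
  ... | inj₂ _ | inj₁ _ = λ ()
  ... | inj₂ (s , _ , _ , fv) | inj₂ (s' , _ , _ , fw) = λ e →
    let s≡s' = fromℕ<-injective s s' _ _ (inj₂-injective e)
    in one-per-round tr fv (subst (λ r → Forces r _ w) (sym s≡s') fw)

achieves-mono : ∀ {n} {A : Adj n} {B t t'} → t ≤ t' → Achieves A B t → Achieves A B t'
achieves-mono {A = A} {B} t≤t' (L , isForceSeq , allBlue) =
  L , isForceSeq , λ v → Chains.rounds-mono A B L t≤t' (allBlue v)

all-blue : ∀ {n} (A : Adj n) → Achieves A ⊤ 0
all-blue A = [] , (tt , λ u w canForce → proj₁ (proj₂ canForce) ∈⊤) , λ v → ∈⊤

-- th(A) = k as soon as k is a lower bound for every achievable |B| + t and
-- some achievable |B| + t is at most k (extra idle rounds fill the gap).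
throttling-number : ∀ {n} {A : Adj n} {B t k} → Achieves A B t → ∣ B ∣ + t ≤ k →
  (∀ B' t' → Achieves A B' t' → k ≤ ∣ B' ∣ + t') → IsThrottlingNumber A k
throttling-number {B = B} {t} {k} achieves |B|+t≤k lower =
  (B , k ∸ ∣ B ∣ ,
   achieves-mono (m+n≤o⇒m≤o∸n t (subst (_≤ k) (+-comm ∣ B ∣ t) |B|+t≤k)) achieves ,
   m+[n∸m]≡n (m+n≤o⇒m≤o ∣ B ∣ |B|+t≤k)) ,
  lower

th-lower : ∀ {n} {A : Adj n} {k m} → IsThrottlingNumber A k →
  (∀ B t → Achieves A B t → m ≤ ∣ B ∣ + t) → m ≤ k
th-lower ((B , t , achieves , refl) , _) lower = lower B t achieves

th≤n : ∀ {n} {A : Adj n} {k} → IsThrottlingNumber A k → k ≤ n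
th≤n {n} {A} (_ , minimal) =
  subst (_ ≤_) (trans (+-identityʳ _) (∣⊤∣≡n n)) (minimal ⊤ 0 (all-blue A))

-- Arithmetic of ⌈2√n − 1⌉

-- (x + y)² = 4xy + (y − x)² for x ≤ y, written with y = x + d.
square-gap : ∀ x d → (x + (x + d)) * (x + (x + d)) ≡ 4 * (x * (x + d)) + d * d
square-gap = solve-∀

am-gm-ordered : ∀ {x y} → x ≤ y → 4 * (x * y) ≤ (x + y) * (x + y)
am-gm-ordered {x} {y} x≤y = subst (λ z → 4 * (x * z) ≤ (x + z) * (x + z)) (m+[n∸m]≡n x≤y)
  (subst (4 * (x * (x + (y ∸ x))) ≤_) (sym (square-gap x (y ∸ x))) (m≤m+n _ _))

am-gm : ∀ x y → 4 * (x * y) ≤ (x + y) * (x + y)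
am-gm x y with ≤-total x y
... | inj₁ x≤y = am-gm-ordered x≤y
... | inj₂ y≤x =
  subst₂ _≤_ (cong (4 *_) (*-comm y x)) (cong (λ z → z * z) (+-comm y x)) (am-gm-ordered y≤x)

-- n ≤ b(t + 1) implies ⌈2√n − 1⌉ ≤ b + t, since 4n ≤ 4b(t + 1) ≤ (b + t + 1)².
ceil-lower : ∀ {n b t c} → n ≤ b * suc t →
  (∀ d → 4 * n ≤ suc d * suc d → c ≤ d) → c ≤ b + t
ceil-lower {n} {b} {t} n≤b[t+1] c-least = c-least (b + t) (begin
  4 * n                     ≤⟨ *-monoʳ-≤ 4 n≤b[t+1] ⟩
  4 * (b * suc t)           ≤⟨ am-gm b (suc t) ⟩
  (b + suc t) * (b + suc t) ≡⟨ cong (λ z → z * z) (+-suc b t) ⟩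
  suc (b + t) * suc (b + t) ∎)
  where open ≤-Reasoning

halves : ∀ m → ∃₂ λ p q → m ≡ p + q × (q ≡ p ⊎ q ≡ suc p)
halves zero = 0 , 0 , refl , inj₁ refl
halves (suc m) with halves m
... | p , q , refl , inj₁ refl = p , suc p , sym (+-suc p p) , inj₂ refl
... | p , q , refl , inj₂ refl = suc p , suc p , refl , inj₁ refl

-- For nearly equal halves m = p + q, 4N ≤ m² implies N ≤ pq, because
-- m² ≤ 4pq + 1 and 4N ≤ 4pq + 1 forces N ≤ pq.
halves-bound : ∀ {N m p q} → m ≡ p + q → q ≡ p ⊎ q ≡ suc p → 4 * N ≤ m * m → N ≤ p * q
halves-bound {N} {p = p} {q} refl near 4N≤m² =
  ≮⇒≥ λ pq<N → 4≰1 (+-cancelʳ-≤ (4 * (p * q)) 4 1 (begin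
    4 + 4 * (p * q)     ≡⟨ *-suc 4 (p * q) ⟨
    4 * suc (p * q)     ≤⟨ *-monoʳ-≤ 4 pq<N ⟩
    4 * N               ≤⟨ 4N≤m² ⟩
    (p + q) * (p + q)   ≤⟨ near-square near ⟩
    4 * (p * q) + 1     ≡⟨ +-comm (4 * (p * q)) 1 ⟩
    1 + 4 * (p * q)     ∎))
  where
  open ≤-Reasoning
  4≰1 : ¬ 4 ≤ 1
  4≰1 (s≤s ())
  even : ∀ p → (p + p) * (p + p) ≡ 4 * (p * p)
  even = solve-∀
  odd : ∀ p → (p + suc p) * (p + suc p) ≡ 4 * (p * suc p) + 1
  odd = solve-∀
  near-square : ∀ {p q} → q ≡ p ⊎ q ≡ suc p → (p + q) * (p + q) ≤ 4 * (p * q) + 1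
  near-square {p} (inj₁ refl) = ≤-trans (≤-reflexive (even p)) (m≤m+n _ 1)
  near-square {p} (inj₂ refl) = ≤-reflexive (odd p)

-- Parameters of the construction: a ≥ 1 initial blue vertices and t rounds
-- with N ≤ (t + 1)a and a + t ≤ c, from 4N ≤ (c + 1)²: split c + 1 = p + q
-- into halves and take a = q, t = p − 1.
jump-parameters : ∀ {N c} → 1 ≤ N → 4 * N ≤ suc c * suc c →
  ∃₂ λ a t → 1 ≤ a × N ≤ suc t * a × a + t ≤ c
jump-parameters {N} {c} 1≤N 4N≤[c+1]² with halves (suc c)
... | zero , q , c+1≡q , near = ⊥-elim (n≮0 (≤-trans 1≤N (halves-bound c+1≡q near 4N≤[c+1]²)))
... | suc t , q , c+1≡t+1+q , near =
  q , t , ≤-trans (s≤s z≤n) (half≤ near) , halves-bound c+1≡t+1+q near 4N≤[c+1]² ,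
  ≤-reflexive (trans (+-comm q t) (sym (suc-injective c+1≡t+1+q)))
  where
  half≤ : ∀ {p q} → q ≡ p ⊎ q ≡ suc p → p ≤ q
  half≤ (inj₁ refl) = ≤-refl
  half≤ (inj₂ refl) = n≤1+n _

-- The jump tournament

jump : ℕ → ℕ → ℕ → Bool
jump a u w = ⌊ w ≟ u + a ⌋ ∨ (⌊ w <? u ⌋ ∧ not ⌊ u ≟ w + a ⌋)

Jump : ∀ {N} → ℕ → Adj N
Jump a u w = jump a (toℕ u) (toℕ w)

jump-elim : ∀ a u w → jump a u w ≡ true → w ≡ u + a ⊎ (w < u × u ≢ w + a)
jump-elim a u w e with w ≟ u + a | w <? u | u ≟ w + a
... | yes w≡u+a | _ | _ = inj₁ w≡u+a
... | no _ | yes w<u | no u≢w+a = inj₂ (w<u , u≢w+a)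
... | no _ | yes _ | yes _ with () ← e
... | no _ | no _ | _ with () ← e

jump-step : ∀ a u → jump a u (u + a) ≡ true
jump-step a u with (u + a) ≟ u + a
... | yes _ = refl
... | no u+a≢u+a = ⊥-elim (u+a≢u+a refl)

jump-back : ∀ a {u w} → w < u → u ≢ w + a → jump a u w ≡ true
jump-back a {u} {w} w<u u≢w+a with w ≟ u + a | w <? u | u ≟ w + a
... | yes _ | _ | _ = refl
... | no _ | yes _ | no _ = refl
... | no _ | no w≮u | _ = ⊥-elim (w≮u w<u)
... | no _ | yes _ | yes u≡w+a = ⊥-elim (u≢w+a u≡w+a)

white-out-neighbour : ∀ {N a} {P : Fin N → Set} {u x : Fin N} →
  (∀ y → toℕ y < toℕ u → P y) → Jump a u x ≡ true → ¬ P x → toℕ x ≡ toℕ u + a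
white-out-neighbour {a = a} below e ¬Px with jump-elim a _ _ e
... | inj₁ x≡u+a = x≡u+a
... | inj₂ (x<u , _) = ⊥-elim (¬Px (below _ x<u))

jump-irreflexive : ∀ {a} → 1 ≤ a → ∀ u → jump a u u ≢ true
jump-irreflexive a≥1 u e with jump-elim _ u u e
... | inj₁ u≡u+a = <-irrefl u≡u+a (m<m+n u a≥1)
... | inj₂ (u<u , _) = <-irrefl refl u<u

jump-total : ∀ a {u w} → u < w → jump a u w ≡ true ⊎ jump a w u ≡ true
jump-total a {u} {w} u<w = case w ≟ u + a of λ where
  (yes w≡u+a) → inj₁ (subst (λ z → jump a u z ≡ true) (sym w≡u+a) (jump-step a u))
  (no w≢u+a) → inj₂ (jump-back a u<w w≢u+a)

jump-antisymmetric : ∀ {a} → 1 ≤ a → ∀ u w → jump a u w ≡ true → jump a w u ≢ true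
jump-antisymmetric {a} a≥1 u w uw wu with jump-elim a u w uw | jump-elim a w u wu
... | inj₁ w≡u+a | inj₁ u≡w+a =
  <-asym (subst (u <_) (sym w≡u+a) (m<m+n u a≥1)) (subst (w <_) (sym u≡w+a) (m<m+n w a≥1))
... | inj₁ w≡u+a | inj₂ (_ , w≢u+a) = w≢u+a w≡u+a
... | inj₂ (_ , u≢w+a) | inj₁ u≡w+a = u≢w+a u≡w+a
... | inj₂ (w<u , _) | inj₂ (u<w , _) = <-asym w<u u<w

jump-orientation : ∀ {N a} → 1 ≤ a → IsOrientation (K N) (Jump a)
jump-orientation {N} {a} a≥1 = arcs-are-edges , edges-are-oriented
  where
  arcs-are-edges : ∀ u v → Jump a u v ≡ true → K N u v ≡ true
  arcs-are-edges u v e with u Fin.≟ v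
  ... | yes refl = ⊥-elim (jump-irreflexive a≥1 (toℕ u) e)
  ... | no _ = refl
  some-arc : ∀ (u v : Fin N) → u ≢ v → Jump a u v ≡ true ⊎ Jump a v u ≡ true
  some-arc u v u≢v with <-cmp (toℕ u) (toℕ v)
  ... | tri< u<v _ _ = jump-total a u<v
  ... | tri≈ _ u≡v _ = ⊥-elim (u≢v (toℕ-injective u≡v))
  ... | tri> _ _ v<u = Sum.swap (jump-total a v<u)
  edges-are-oriented : ∀ u v → K N u v ≡ true →
    (Jump a u v ≡ true ⊎ Jump a v u ≡ true) × ¬ (Jump a u v ≡ true × Jump a v u ≡ true)
  edges-are-oriented u v e with u Fin.≟ v
  ... | no u≢v = some-arc u v u≢v , λ (uv , vu) → jump-antisymmetric a≥1 (toℕ u) (toℕ v) uv vu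
  ... | yes _ with () ← e

-- If N ≤ a no step arc u → u + a stays inside Fin N, and the jump
-- tournament is the transitive tournament.
jump-transitive : ∀ {N a} → N ≤ a → IsTransitive (Jump {N} a)
jump-transitive {N} {a} N≤a u w = forward , backward
  where
  beyond : ∀ (x y : Fin N) → toℕ x ≢ toℕ y + a
  beyond x y x≡y+a =
    <⇒≱ (Finₚ.toℕ<n x) (≤-trans N≤a (subst (a ≤_) (sym x≡y+a) (m≤n+m a (toℕ y))))
  forward : Jump a u w ≡ true → toℕ w < toℕ u
  forward e with jump-elim a _ _ e
  ... | inj₁ w≡u+a = ⊥-elim (beyond w u w≡u+a)
  ... | inj₂ (w<u , _) = w<u
  backward : toℕ w < toℕ u → Jump a u w ≡ true
  backward w<u = jump-back a w<u (beyond u w)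

IsPrefix : ∀ {N} → Subset N → ℕ → Set
IsPrefix {N} S k = ∀ (v : Fin N) → (v ∈ S → toℕ v < k) × (toℕ v < k → v ∈ S)

prefix : ∀ N → ℕ → Subset N
prefix zero k = []
prefix (suc N) zero = outside ∷ prefix N zero
prefix (suc N) (suc k) = inside ∷ prefix N k

prefix-isPrefix : ∀ N k → IsPrefix (prefix N k) k
prefix-isPrefix (suc N) zero Fin.zero = (λ ()) , (λ ())
prefix-isPrefix (suc N) (suc k) Fin.zero = (λ _ → s≤s z≤n) , (λ _ → here)
prefix-isPrefix (suc N) zero (Fin.suc v) =
  (λ { (there p) → ⊥-elim (n≮0 (proj₁ (prefix-isPrefix N zero v) p)) }) , (λ ())
prefix-isPrefix (suc N) (suc k) (Fin.suc v) =
  (λ { (there p) → s≤s (proj₁ (prefix-isPrefix N k v) p) }) ,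
  (λ { (s≤s v<k) → there (proj₂ (prefix-isPrefix N k v) v<k) })

∣prefix∣≤ : ∀ N k → ∣ prefix N k ∣ ≤ k
∣prefix∣≤ zero k = z≤n
∣prefix∣≤ (suc N) zero = ∣prefix∣≤ N zero
∣prefix∣≤ (suc N) (suc k) = s≤s (∣prefix∣≤ N k)

prefix-extend : ∀ {N} {S : Subset N} {k} {w : Fin N} → IsPrefix S k → toℕ w ≡ k →
  IsPrefix (S ∪ ⁅ w ⁆) (suc k)
prefix-extend {S = S} {k} {w} S-prefix w≡k v = into , onto
  where
  into : v ∈ S ∪ ⁅ w ⁆ → toℕ v < suc k
  into v∈ with x∈p∪q⁻ S ⁅ w ⁆ v∈
  ... | inj₁ v∈S = m<n⇒m<1+n (proj₁ (S-prefix v) v∈S)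
  ... | inj₂ v∈w = s≤s (≤-reflexive (trans (cong toℕ (x∈⁅y⁆⇒x≡y w v∈w)) w≡k))
  onto : toℕ v < suc k → v ∈ S ∪ ⁅ w ⁆
  onto v<1+k with m≤n⇒m<n∨m≡n (≤-pred v<1+k)
  ... | inj₁ v<k = x∈p∪q⁺ (inj₁ (proj₂ (S-prefix v) v<k))
  ... | inj₂ v≡k = x∈p∪q⁺ (inj₂ (subst (_∈ ⁅ w ⁆) (toℕ-injective (trans w≡k (sym v≡k))) (x∈⁅x⁆ w)))

-- Forcing in the jump tournament

module JumpForcing (m a : ℕ) (a≥1 : 1 ≤ a) where

  N : ℕ
  N = suc m

  B₀ : Subset N
  B₀ = prefix N a

  -- The vertex with value k < N.
  vertex : ℕ → Fin N
  vertex k = k mod N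

  toℕ-vertex : ∀ {k} → k < N → toℕ (vertex k) ≡ k
  toℕ-vertex k<N = trans (toℕ-fromℕ< _) (m<n⇒m%n≡m k<N)

  has-target : ∀ {k} → k < N ∸ a → k + a < N
  has-target {k} k<N∸a = m≤o∸n⇒m+n≤o (suc k) (<⇒≤ a<N) k<N∸a
    where
    a<N : a < N
    a<N = m∸n≢0⇒n<m (λ N∸a≡0 → n≮0 (subst (k <_) N∸a≡0 k<N∸a))

  shifts : ℕ → ℕ → List (Force N)
  shifts j zero = []
  shifts j (suc r) = (vertex j , vertex (j + a)) ∷ shifts (suc j) r

  shifts-∈ : ∀ {j r k} → j ≤ k → k < j + r → (vertex k , vertex (k + a)) ∈ₗ shifts j r
  shifts-∈ {j} {zero} j≤k k<j+0 = ⊥-elim (<⇒≱ k<j+0 (subst (_≤ _) (sym (+-identityʳ j)) j≤k))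
  shifts-∈ {j} {suc r} {k} j≤k k<j+1+r with m≤n⇒m<n∨m≡n j≤k
  ... | inj₁ j<k = Any.there (shifts-∈ j<k (subst (k <_) (+-suc j r) k<j+1+r))
  ... | inj₂ refl = Any.here refl

  shifts-valid : ∀ j r {S} → j + r ≤ N ∸ a → IsPrefix S (j + a) →
    ValidSeq (Jump a) S (shifts j r) × IsPrefix (run S (shifts j r)) (j + r + a)
  shifts-valid j zero {S} _ S-prefix =
    tt , subst (IsPrefix S) (cong (_+ a) (sym (+-identityʳ j))) S-prefix
  shifts-valid j (suc r) {S} j+1+r≤N∸a S-prefix =
    (can-force , proj₁ rest) , subst (IsPrefix _) (cong (_+ a) (sym (+-suc j r))) (proj₂ rest)
    where
    j+a<N : j + a < N
    j+a<N = has-target (≤-trans (s≤s (m≤m+n j r)) (subst (_≤ N ∸ a) (+-suc j r) j+1+r≤N∸a))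
    j≡ : toℕ (vertex j) ≡ j
    j≡ = toℕ-vertex (≤-<-trans (m≤m+n j a) j+a<N)
    j+a≡ : toℕ (vertex (j + a)) ≡ j + a
    j+a≡ = toℕ-vertex j+a<N
    below-j : ∀ y → toℕ y < toℕ (vertex j) → y ∈ S
    below-j y y<j = proj₂ (S-prefix y) (≤-trans y<j (≤-trans (≤-reflexive j≡) (m≤m+n j a)))
    can-force : CanForce (Jump a) S (vertex j) (vertex (j + a))
    can-force =
      proj₂ (S-prefix _) (subst (_< j + a) (sym j≡) (m<m+n j a≥1)) ,
      (λ j+a∈S → <-irrefl j+a≡ (proj₁ (S-prefix _) j+a∈S)) ,
      subst₂ (λ u w → jump a u w ≡ true) (sym j≡) (sym j+a≡) (jump-step a j) ,
      λ x e x∉S → toℕ-injective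
        (trans (white-out-neighbour below-j e x∉S) (trans (cong (_+ a) j≡) (sym j+a≡)))
    rest : ValidSeq (Jump a) (S ∪ ⁅ vertex (j + a) ⁆) (shifts (suc j) r) ×
           IsPrefix (run (S ∪ ⁅ vertex (j + a) ⁆) (shifts (suc j) r)) (suc j + r + a)
    rest = shifts-valid (suc j) r (subst (_≤ N ∸ a) (+-suc j r) j+1+r≤N∸a)
                        (prefix-extend S-prefix j+a≡)

  shift-list : List (Force N)
  shift-list = shifts 0 (N ∸ a)

  -- All shifts, performed in order, form a complete forcing sequence of B₀:
  -- afterwards every vertex is blue, so no force is possible.
  shift-list-isForceSeq : IsForceSeq (Jump a) B₀ shift-list
  shift-list-isForceSeq =
    proj₁ performed ,
    λ u w canForce → proj₁ (proj₂ canForce) (proj₂ (proj₂ performed w) (all-below w))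
    where
    performed : ValidSeq (Jump a) B₀ shift-list × IsPrefix (run B₀ shift-list) (N ∸ a + a)
    performed = shifts-valid 0 (N ∸ a) ≤-refl (prefix-isPrefix N a)
    all-below : ∀ (w : Fin N) → toℕ w < N ∸ a + a
    all-below w = ≤-trans (Finₚ.toℕ<n w) (subst (N ≤_) (+-comm a (N ∸ a)) (m≤n+m∸n N a))

  R : ℕ → Fin N → Set
  R = Rounds (Jump a) B₀ shift-list

  blue-sound : ∀ d {v} → R d v → toℕ v < suc d * a
  blue-sound zero {v} v∈B₀ =
    subst (toℕ v <_) (sym (+-identityʳ a)) (proj₁ (prefix-isPrefix N a v) v∈B₀)
  blue-sound (suc d) (inj₁ r) = ≤-trans (blue-sound d r) (m≤n+m _ a)
  blue-sound (suc d) {w} (inj₂ (_ , u , _ , ru , auw , _)) with jump-elim a _ _ auw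
  ... | inj₁ w≡u+a = begin-strict
    toℕ w         ≡⟨ w≡u+a ⟩
    toℕ u + a     <⟨ +-monoˡ-< a (blue-sound d ru) ⟩
    suc d * a + a ≡⟨ +-comm (suc d * a) a ⟩
    suc (suc d) * a ∎
    where open ≤-Reasoning
  ... | inj₂ (w<u , _) = <-trans w<u (≤-trans (blue-sound d ru) (m≤n+m _ a))

  blue-complete : ∀ d v → toℕ v < suc d * a → R d v
  blue-complete zero v v<a =
    proj₂ (prefix-isPrefix N a v) (subst (toℕ v <_) (+-identityʳ a) v<a)
  blue-complete (suc d) w w<[d+2]a with toℕ w <? suc d * a
  ... | yes w<[d+1]a = inj₁ (blue-complete d w w<[d+1]a)
  ... | no w≮[d+1]a =
    inj₂ ((λ r → w≮[d+1]a (blue-sound d r)) , vertex k , listed , blue-k , arc , only)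
    where
    -- w is the target of its predecessor k = w − a, which is blue after d rounds.
    k : ℕ
    k = toℕ w ∸ a
    k+a≡w : k + a ≡ toℕ w
    k+a≡w = m∸n+n≡m (≤-trans (m≤m+n a _) (≮⇒≥ w≮[d+1]a))
    k+a<N : k + a < N
    k+a<N = subst (_< N) (sym k+a≡w) (Finₚ.toℕ<n w)
    k≡ : toℕ (vertex k) ≡ k
    k≡ = toℕ-vertex (≤-<-trans (m≤m+n k a) k+a<N)
    target≡w : vertex (k + a) ≡ w
    target≡w = toℕ-injective (trans (toℕ-vertex k+a<N) k+a≡w)
    listed : (vertex k , w) ∈ₗ shift-list
    listed = subst (λ z → (vertex k , z) ∈ₗ shift-list) target≡w
      (shifts-∈ z≤n (m+n≤o⇒m≤o∸n (suc k) k+a<N))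
    k<[d+1]a : k < suc d * a
    k<[d+1]a = +-cancelʳ-< a k (suc d * a)
      (subst₂ _<_ (sym k+a≡w) (+-comm a (suc d * a)) w<[d+2]a)
    blue-k : R d (vertex k)
    blue-k = blue-complete d (vertex k) (subst (_< suc d * a) (sym k≡) k<[d+1]a)
    arc : Jump a (vertex k) w ≡ true
    arc = subst₂ (λ u x → jump a u x ≡ true) (sym k≡) k+a≡w (jump-step a k)
    only : ∀ x → Jump a (vertex k) x ≡ true → ¬ R d x → x ≡ w
    only x e x-white = toℕ-injective (trans
      (white-out-neighbour (λ y y<k → blue-complete d y (<-trans y<k k-value<[d+1]a)) e x-white)
      (trans (cong (_+ a) k≡) k+a≡w))
      where
      k-value<[d+1]a : toℕ (vertex k) < suc d * a
      k-value<[d+1]a = subst (_< suc d * a) (sym k≡) k<[d+1]a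

  jump-achieves : ∀ t → N ≤ suc t * a → Achieves (Jump a) B₀ t
  jump-achieves t N≤[t+1]a =
    shift-list , shift-list-isForceSeq , λ v → blue-complete t v (≤-trans (Finₚ.toℕ<n v) N≤[t+1]a)

theorem3p7 : ∀ (n : ℕ) → 1 ≤ n → ∀ (c : ℕ) → IsCeil2SqrtMinus1 n c →
    IsMinOrientTh (K n) c × IsMaxOrientTh (K n) n
theorem3p7 (suc m) 1≤n c (4n≤[c+1]² , c-least) = minimum , maximum
  where
  n : ℕ
  n = suc m
  c≤ : ∀ (A : Adj n) B t → Achieves A B t → c ≤ ∣ B ∣ + t
  c≤ A B t achieves = ceil-lower {b = ∣ B ∣} {t} (chain-bound achieves) c-least
  minimum : IsMinOrientTh (K n) c
  minimum with jump-parameters 1≤n 4n≤[c+1]²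
  ... | a , t , a≥1 , n≤[t+1]a , a+t≤c =
    (Jump a , jump-orientation a≥1 ,
     throttling-number (jump-achieves t n≤[t+1]a)
       (≤-trans (+-monoˡ-≤ t (∣prefix∣≤ n a)) a+t≤c) (c≤ (Jump a))) ,
    λ A k _ th → th-lower th (c≤ A)
    where open JumpForcing m a a≥1
  maximum : IsMaxOrientTh (K n) n
  maximum =
    (Jump n , jump-orientation 1≤n ,
     throttling-number (all-blue (Jump n)) (≤-reflexive (trans (+-identityʳ _) (∣⊤∣≡n n)))
       (λ B t → transitive-bound (jump-transitive ≤-refl))) ,
    λ A k _ → th≤n
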